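{- Let $n,k$ be positive integers. If there exists an $\mathrm{SH}^*(n;k)$, then there exist (1) a pair of orthogonal cyclic $k$-cycle decompositions of $K_{2nk+1}$, and (2) a pair of orthogonal cyclic $k$-cycle decompositions of $K_{2nk+2}-I$.
   Context: An $\mathrm{H}(n;k)$ (square integer Heffter array) is an $n\times n$ partially filled array with entries in $\{\pm1,\dots,\pm nk\}\subset\mathbb{Z}$ such that no two entries agree in absolute value, each row and each column has exactly $k$ filled cells, and the entries of every row and every column sum to $0$ in $\mathbb{Z}$. An ordering $(a_1,\dots,a_k)$ of a set of integers is simple modulo $v$ if its partial sums $s_i=\sum_{j\le i}a_j$ ($1\le i\le k$) are pairwise distinct modulo $v$. An $\mathrm{SH}^*(n;k)$ is an $\mathrm{H}(n;k)$ in which the natural ordering of each row (left to right, skipping empty cells) and of each column (top to bottom, skipping empty cells) is simple both modulo $2nk+1$ and modulo $2nk+2$. A $k$-cycle decomposition of a graph $\Gamma$ is a set of $k$-cycles of $\Gamma$ partitioning its edges; with vertex set $\mathbb{Z}_v$ it is cyclic if it is invariant under $x\mapsto x+1$. Two $k$-cycle decompositions are orthogonal if any cycle of one and any cycle of the other share at most one edge. $K_{2t}-I$ is the complete graph on $\mathbb{Z}_{2t}$ minus the edges $[i,i+t]$, $i=0,\dots,t-1$. -}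

module Defs where

open import Data.Nat as ℕ using (ℕ; zero; suc; _≤_)
open import Data.Nat.Properties using (suc-injective)
open import Data.Integer as ℤ using (ℤ; +_; _-_; ∣_∣)
open import Data.Integer.Divisibility using () renaming (_∣_ to _∣ℤ_)
open import Data.Fin using (Fin; toℕ; lower₁) renaming (zero to fzero; suc to fsuc)
open import Data.Maybe using (Maybe; just)
open import Data.List using (List; []; _∷_; mapMaybe; allFin; length; foldr)
open import Data.List.Relation.Unary.AllPairs using (AllPairs)
open import Data.Product using (Σ; ∃; ∃-syntax; _×_; _,_)
open import Data.Sum using (_⊎_)
open import Function using (_⇔_)
open import Relation.Nullary using (¬_; yes; no)
open import Relation.Binary.PropositionalEquality using (_≡_; _≢_; refl; cong)

-- An n × n partially filled array over ℤ (nothing = empty cell).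
Array : ℕ → Set
Array n = Fin n → Fin n → Maybe ℤ

-- Natural ordering of row i (left to right) and column j (top to bottom),
-- skipping empty cells.
row : ∀ {n} → Array n → Fin n → List ℤ
row {n} A i = mapMaybe (λ j → A i j) (allFin n)

col : ∀ {n} → Array n → Fin n → List ℤ
col {n} A j = mapMaybe (λ i → A i j) (allFin n)

sumℤ : List ℤ → ℤ
sumℤ = foldr ℤ._+_ (+ 0)

record IsHeffter (n k : ℕ) (A : Array n) : Set where
  field
    entries  : ∀ i j z → A i j ≡ just z → 1 ≤ ∣ z ∣ × ∣ z ∣ ≤ n ℕ.* k
    absDistinct : ∀ i j i' j' z z' → A i j ≡ just z → A i' j' ≡ just z' →
                  ∣ z ∣ ≡ ∣ z' ∣ → i ≡ i' × j ≡ j'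
    rowSize  : ∀ i → length (row A i) ≡ k
    colSize  : ∀ j → length (col A j) ≡ k
    rowSum   : ∀ i → sumℤ (row A i) ≡ + 0
    colSum   : ∀ j → sumℤ (col A j) ≡ + 0

partialSums : ℤ → List ℤ → List ℤ
partialSums acc []       = []
partialSums acc (x ∷ xs) = (acc ℤ.+ x) ∷ partialSums (acc ℤ.+ x) xs

SimpleMod : ℕ → List ℤ → Set
SimpleMod v l = AllPairs (λ a b → ¬ ((+ v) ∣ℤ (a - b))) (partialSums (+ 0) l)

record SHStar (n k : ℕ) : Set where
  field
    array   : Array n
    heffter : IsHeffter n k array
    rowSimple₁ : ∀ i → SimpleMod (suc (2 ℕ.* n ℕ.* k)) (row array i)
    rowSimple₂ : ∀ i → SimpleMod (2 ℕ.+ 2 ℕ.* n ℕ.* k) (row array i)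
    colSimple₁ : ∀ j → SimpleMod (suc (2 ℕ.* n ℕ.* k)) (col array j)
    colSimple₂ : ∀ j → SimpleMod (2 ℕ.+ 2 ℕ.* n ℕ.* k) (col array j)

Graph : ℕ → Set₁
Graph v = Fin v → Fin v → Set

K : (v : ℕ) → Graph v
K v x y = x ≢ y

-- K_{2t} − I : complete graph on ℤ_{2t} minus the edges [i, i+t]
K-I : (t : ℕ) → Graph (2 ℕ.* t)
K-I t x y = x ≢ y × toℕ x ≢ toℕ y ℕ.+ t × toℕ y ≢ toℕ x ℕ.+ t

record Cycle (k v : ℕ) : Set where
  field
    three≤k : 3 ≤ k
    vert    : Fin k → Fin v
    inj     : ∀ i j → vert i ≡ vert j → i ≡ j
open Cycle public

IsNext : ∀ {k} → Fin k → Fin k → Set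
IsNext {k} i j = toℕ j ≡ suc (toℕ i) ⊎ (suc (toℕ i) ≡ k × toℕ j ≡ 0)

HasEdge : ∀ {k v} → Cycle k v → Fin v → Fin v → Set
HasEdge C x y = ∃[ i ] ∃[ j ] IsNext i j ×
  ((vert C i ≡ x × vert C j ≡ y) ⊎ (vert C i ≡ y × vert C j ≡ x))

SameCycle : ∀ {k v} → Cycle k v → Cycle k v → Set
SameCycle C D = ∀ x y → HasEdge C x y ⇔ HasEdge D x y

shift : ∀ {v} → Fin v → Fin v
shift {suc m} x with toℕ x ℕ.≟ m
... | yes _ = fzero
... | no ne = lower₁ (fsuc x) (λ e → ne (sym' (suc-injective e)))
  where
  sym' : ∀ {a b : ℕ} → a ≡ b → b ≡ a
  sym' refl = refl

record Decomposition {v} (k : ℕ) (Γ : Graph v) : Set where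
  field
    size   : ℕ
    cyc    : Fin size → Cycle k v
    sound  : ∀ i x y → HasEdge (cyc i) x y → Γ x y
    cover  : ∀ x y → Γ x y → ∃[ i ] HasEdge (cyc i) x y ×
               (∀ j → HasEdge (cyc j) x y → j ≡ i)
open Decomposition public

Cyclic : ∀ {v k} {Γ : Graph v} → Decomposition k Γ → Set
Cyclic D = ∀ i → ∃[ j ] ∀ x y →
  HasEdge (cyc D i) x y ⇔ HasEdge (cyc D j) (shift x) (shift y)

Orthogonal : ∀ {v k} {Γ : Graph v} → Decomposition k Γ → Decomposition k Γ → Set
Orthogonal D E = ∀ i j x y x' y' →
  HasEdge (cyc D i) x y → HasEdge (cyc E j) x y →
  HasEdge (cyc D i) x' y' → HasEdge (cyc E j) x' y' →
  (x ≡ x' × y ≡ y') ⊎ (x ≡ y' × y ≡ x')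

OrthCyclicPair : ∀ {v} (k : ℕ) (Γ : Graph v) → Set
OrthCyclicPair k Γ = Σ (Decomposition k Γ) λ D → Σ (Decomposition k Γ) λ E →
  Cyclic D × Cyclic E × Orthogonal D E

-- Each row (a₁, …, a_k) of the array, read through its partial sums s₁, …, s_k = 0, is a closed
-- walk in ℤ_v whose consecutive differences are the entries; simplicity modulo v makes it a k-cycle,
-- and its v translates form a cyclic family.  The entries ±1, …, ±nk represent every nonzero residue
-- modulo 2nk+1 exactly once, and modulo 2nk+2 every residue except 0 and nk+1; these are precisely
-- the differences of the edges of K_{2nk+1} and of K_{2nk+2} − I.  So every edge arises from exactly
-- one entry and one translate, and the rows (likewise the columns) give a cyclic decomposition.
-- An edge shared by a row cycle and a column cycle must come from the entry in their common cell,
-- and that entry labels a single edge of each cycle, which gives orthogonality.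

module Submission where

open import Defs
open import Data.Bool using (Bool; true; false; not; if_then_else_)
open import Data.Empty using (⊥-elim)
open import Data.Fin as Fin using (Fin; toℕ; fromℕ<; combine; remQuot)
import Data.Fin.Properties as Fin
open import Data.Integer as ℤ using (ℤ; +_; -[1+_]; +[1+_]; _-_; -_; ∣_∣)
import Data.Integer.Properties as ℤ
open import Data.Integer.Divisibility.Signed as Div using (_∣_)
open import Data.Integer.DivMod using (_%ℕ_; _/ℕ_; n%ℕd<d; a≡a%ℕn+[a/ℕn]*n)
open import Data.Integer.Tactic.RingSolver using (solve-∀)
open import Data.List using (List; []; _∷_; mapMaybe; length; allFin)
open import Data.List.Relation.Unary.All using (All; []; _∷_)
open import Data.List.Relation.Unary.AllPairs using (AllPairs; []; _∷_)
open import Data.List.Relation.Unary.Unique.Propositional.Properties using (allFin⁺)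
open import Data.Maybe using (Maybe; just; nothing)
import Data.Maybe.Properties as Maybe
open import Data.Nat as ℕ using (ℕ; zero; suc; z≤n; s≤s; NonZero)
import Data.Nat.Divisibility as ℕ
import Data.Nat.Properties as ℕ
import Data.Nat.Tactic.RingSolver as ℕ-Solver
open import Data.Product using (∃-syntax; _×_; _,_; proj₁; proj₂; swap)
open import Data.Sum using (_⊎_; inj₁; inj₂; [_,_]′)
open import Function using (_∘_; _⇔_; mk⇔)
open import Relation.Binary.Definitions using (tri<; tri≈; tri>)
open import Relation.Binary.PropositionalEquality
open import Relation.Nullary using (yes; no)

signed : Bool → ℤ → ℤ
signed true  z = z
signed false z = - z

∣signed∣ : ∀ s z → ∣ signed s z ∣ ≡ ∣ z ∣
∣signed∣ true  z = refl
∣signed∣ false z = ℤ.∣-i∣≡∣i∣ z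

signed-injective : ∀ s s' {z} → z ≢ + 0 → signed s z ≡ signed s' z → s ≡ s'
signed-injective true  true  z≢0 _ = refl
signed-injective false false z≢0 _ = refl
signed-injective true  false {+ zero} z≢0 _ = ⊥-elim (z≢0 refl)
signed-injective false true  {+ zero} z≢0 _ = ⊥-elim (z≢0 refl)

∣∣≡⇒signed : ∀ i j → ∣ i ∣ ≡ ∣ j ∣ → ∃[ s ] j ≡ signed s i
∣∣≡⇒signed (+ m)      (+ .m)       refl = true , refl
∣∣≡⇒signed +[1+ m ]   -[1+ .m ]    refl = false , refl
∣∣≡⇒signed -[1+ m ]   (+ .(suc m)) refl = false , refl
∣∣≡⇒signed -[1+ m ]   -[1+ .m ]    refl = true , refl

v∣i∧∣i∣<v⇒i≡0 : ∀ {v i} → + v ∣ i → ∣ i ∣ ℕ.< v → i ≡ + 0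
v∣i∧∣i∣<v⇒i≡0 {i = i} v∣i ∣i∣<v with ∣ i ∣ ℕ.≟ 0
... | yes ∣i∣≡0 = ℤ.∣i∣≡0⇒i≡0 ∣i∣≡0
... | no  ∣i∣≢0 = ⊥-elim (ℕ.<⇒≱ ∣i∣<v (ℕ.∣⇒≤ ⦃ ℕ.≢-nonZero ∣i∣≢0 ⦄ (Div.∣⇒∣ᵤ v∣i)))

∣+a-+b∣≡d⇒ : ∀ a b {d} → ∣ + a - + b ∣ ≡ d → a ≡ b ℕ.+ d ⊎ b ≡ a ℕ.+ d
∣+a-+b∣≡d⇒ a b refl rewrite ℤ.[+m]-[+n]≡m⊖n a b with ℕ.≤-total a b
... | inj₁ a≤b = inj₂ (trans (sym (ℕ.m+[n∸m]≡n a≤b)) (cong (a ℕ.+_) (sym (ℤ.∣⊖∣-≤ a≤b))))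
... | inj₂ b≤a = inj₁ (trans (sym (ℕ.m+[n∸m]≡n b≤a))
                   (cong (b ℕ.+_) (sym (trans (ℤ.∣m⊖n∣≡∣n⊖m∣ a b) (ℤ.∣⊖∣-≤ b≤a)))))

∣+a-+b∣<v : ∀ {v a b} → a ℕ.< v → b ℕ.< v → ∣ + a - + b ∣ ℕ.< v
∣+a-+b∣<v {a = a} {b} a<v b<v with ∣+a-+b∣≡d⇒ a b refl
... | inj₁ a≡b+d = ℕ.≤-<-trans (ℕ.m≤n+m _ b) (subst (ℕ._< _) a≡b+d a<v)
... | inj₂ b≡a+d = ℕ.≤-<-trans (ℕ.m≤n+m _ a) (subst (ℕ._< _) b≡a+d b<v)

∣+[a+d]-+a∣≡d : ∀ a d → ∣ + (a ℕ.+ d) - + a ∣ ≡ d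
∣+[a+d]-+a∣≡d a d = cong ∣_∣ (trans (cong (λ i → i - + a) (ℤ.pos-+ a d)) (eq (+ a) (+ d)))
  where eq : ∀ a d → (a ℤ.+ d) - a ≡ d
        eq = solve-∀

module Congruence (v : ℕ) ⦃ _ : NonZero v ⦄ where
  open import Data.Integer using (_+_; _*_)

  infix 4 _≈_
  record _≈_ (a b : ℤ) : Set where
    constructor mk≈
    field divides : + v ∣ (a - b)
  open _≈_ public

  ≈-reflexive : ∀ {a b} → a ≡ b → a ≈ b
  ≈-reflexive {a} refl = mk≈ (Div.divides (+ 0) (ℤ.+-inverseʳ a))

  ≈-refl : ∀ {a} → a ≈ a
  ≈-refl = ≈-reflexive refl

  ≈-sym : ∀ {a b} → a ≈ b → b ≈ a
  ≈-sym {a} {b} (mk≈ d) = mk≈ (subst (+ v ∣_) (eq a b) (Div.∣m⇒∣-m d))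
    where eq : ∀ a b → - (a - b) ≡ b - a
          eq = solve-∀

  ≈-trans : ∀ {a b c} → a ≈ b → b ≈ c → a ≈ c
  ≈-trans {a} {b} {c} (mk≈ d) (mk≈ e) = mk≈ (subst (+ v ∣_) (eq a b c) (Div.∣m∣n⇒∣m+n d e))
    where eq : ∀ a b c → (a - b) + (b - c) ≡ a - c
          eq = solve-∀

  ≈-+ : ∀ {a b c d} → a ≈ b → c ≈ d → a + c ≈ b + d
  ≈-+ {a} {b} {c} {d} (mk≈ e) (mk≈ f) = mk≈ (subst (+ v ∣_) (eq a b c d) (Div.∣m∣n⇒∣m+n e f))
    where eq : ∀ a b c d → (a - b) + (c - d) ≡ (a + c) - (b + d)
          eq = solve-∀

  ≈-neg : ∀ {a b} → a ≈ b → - a ≈ - b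
  ≈-neg {a} {b} (mk≈ d) = mk≈ (subst (+ v ∣_) (eq a b) (Div.∣m⇒∣-m d))
    where eq : ∀ a b → - (a - b) ≡ - a - - b
          eq = solve-∀

  ≈-- : ∀ {a b c d} → a ≈ b → c ≈ d → a - c ≈ b - d
  ≈-- a≈b c≈d = ≈-+ a≈b (≈-neg c≈d)

  b-a≈-c⇒a-b≈c : ∀ {a b c} → b - a ≈ - c → a - b ≈ c
  b-a≈-c⇒a-b≈c {a} {b} {c} b-a≈-c =
    ≈-trans (≈-reflexive (eq a b)) (≈-trans (≈-neg b-a≈-c) (≈-reflexive (ℤ.neg-involutive c)))
    where eq : ∀ a b → a - b ≡ - (b - a)
          eq = solve-∀

  ≈-cancelˡ : ∀ c {a b} → c + a ≈ c + b → a ≈ b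
  ≈-cancelˡ c {a} {b} c+a≈c+b =
    ≈-trans (≈-reflexive (eq c a)) (≈-trans (≈-+ (≈-refl { - c}) c+a≈c+b) (≈-reflexive (sym (eq c b))))
    where eq : ∀ c a → a ≡ - c + (c + a)
          eq = solve-∀

  ≈-cancelʳ : ∀ c {a b} → a + c ≈ b + c → a ≈ b
  ≈-cancelʳ c {a} {b} a+c≈b+c =
    ≈-cancelˡ c (≈-trans (≈-reflexive (ℤ.+-comm c a)) (≈-trans a+c≈b+c (≈-reflexive (ℤ.+-comm b c))))

  ≈-close⇒≡ : ∀ {a b} → a ≈ b → ∣ a ∣ ℕ.+ ∣ b ∣ ℕ.< v → a ≡ b
  ≈-close⇒≡ {a} {b} (mk≈ d) small =
    ℤ.i-j≡0⇒i≡j a b (v∣i∧∣i∣<v⇒i≡0 d (ℕ.≤-<-trans (ℤ.∣i-j∣≤∣i∣+∣j∣ a b) small))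

  signed≈signed-complement : ∀ s {D} → D ℕ.≤ v → signed s (+ D) ≈ signed (not s) (+ (v ℕ.∸ D))
  signed≈signed-complement s {D} D≤v = mk≈ (subst (+ v ∣_) (eq s) (divides-signed s))
    where
    D+[v-D]≡v : + D + + (v ℕ.∸ D) ≡ + v
    D+[v-D]≡v = trans (ℤ.pos-+ D (v ℕ.∸ D)) (cong +_ (ℕ.m+[n∸m]≡n D≤v))
    divides-signed : ∀ s → + v ∣ signed s (+ v)
    divides-signed true  = Div.∣-refl
    divides-signed false = Div.∣m⇒∣-m Div.∣-refl
    eq : ∀ s → signed s (+ v) ≡ signed s (+ D) - signed (not s) (+ (v ℕ.∸ D))
    eq true  = trans (sym D+[v-D]≡v) (cong (λ w → + D + w) (sym (ℤ.neg-involutive (+ (v ℕ.∸ D)))))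
    eq false = trans (cong -_ (sym D+[v-D]≡v)) (ℤ.neg-distrib-+ (+ D) _)

  toℤ : Fin v → ℤ
  toℤ x = + toℕ x

  fromℤ : ℤ → Fin v
  fromℤ z = fromℕ< (n%ℕd<d z v)

  toℤ-fromℤ : ∀ z → toℤ (fromℤ z) ≈ z
  toℤ-fromℤ z = ≈-sym (mk≈ (Div.divides (z /ℕ v) (begin
      z - toℤ (fromℤ z)                        ≡⟨ cong (λ w → z - w) (cong +_ (Fin.toℕ-fromℕ< (n%ℕd<d z v))) ⟩
      z - + (z %ℕ v)                           ≡⟨ cong (λ w → w - + (z %ℕ v)) (a≡a%ℕn+[a/ℕn]*n z v) ⟩
      (+ (z %ℕ v) + (z /ℕ v) * + v) - + (z %ℕ v) ≡⟨ eq (+ (z %ℕ v)) ((z /ℕ v) * + v) ⟩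
      (z /ℕ v) * + v                           ∎)))
    where
    open ≡-Reasoning
    eq : ∀ a b → (a + b) - a ≡ b
    eq = solve-∀

  ∣toℤ-toℤ∣<v : ∀ x y → ∣ toℤ x - toℤ y ∣ ℕ.< v
  ∣toℤ-toℤ∣<v x y = ∣+a-+b∣<v (Fin.toℕ<n x) (Fin.toℕ<n y)

  toℤ-injective : ∀ {x y} → toℤ x ≈ toℤ y → x ≡ y
  toℤ-injective {x} {y} (mk≈ d) =
    Fin.toℕ-injective (ℤ.+-injective (ℤ.i-j≡0⇒i≡j _ _ (v∣i∧∣i∣<v⇒i≡0 d (∣toℤ-toℤ∣<v x y))))

  1≤∣toℤ-toℤ∣ : ∀ {x y} → x ≢ y → 1 ℕ.≤ ∣ toℤ y - toℤ x ∣
  1≤∣toℤ-toℤ∣ {x} {y} x≢y = ℕ.n≢0⇒n>0 λ ∣y-x∣≡0 →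
    x≢y (sym (toℤ-injective (≈-reflexive (ℤ.i-j≡0⇒i≡j _ _ (ℤ.∣i∣≡0⇒i≡0 ∣y-x∣≡0)))))

  ≈-nonzero⇒≢ : ∀ {x y z} → 1 ℕ.≤ ∣ z ∣ → ∣ z ∣ ℕ.< v → toℤ y - toℤ x ≈ z → x ≢ y
  ≈-nonzero⇒≢ {x} {z = z} 1≤∣z∣ ∣z∣<v y-x≈z refl with () ←
    subst (1 ℕ.≤_) (cong ∣_∣ (sym (≈-close⇒≡ (≈-trans (≈-reflexive (sym (ℤ.+-inverseʳ (toℤ x)))) y-x≈z) ∣z∣<v))) 1≤∣z∣

  ≈-representative-≤ : ∀ {B} w → 1 ℕ.≤ ∣ w ∣ → ∣ w ∣ ℕ.< v → (B ℕ.< ∣ w ∣ → v ℕ.∸ ∣ w ∣ ℕ.≤ B) →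
    ∃[ z ] (1 ℕ.≤ ∣ z ∣ × ∣ z ∣ ℕ.≤ B) × w ≈ z
  ≈-representative-≤ {B} w 1≤∣w∣ ∣w∣<v large with ∣ w ∣ ℕ.≤? B
  ... | yes ∣w∣≤B = w , (1≤∣w∣ , ∣w∣≤B) , ≈-refl
  ... | no  ∣w∣≰B = let s , w≡sd = ∣∣≡⇒signed (+ ∣ w ∣) w refl in
    signed (not s) (+ (v ℕ.∸ ∣ w ∣)) ,
    subst (λ d → 1 ℕ.≤ d × d ℕ.≤ B) (sym (∣signed∣ (not s) _)) (ℕ.m<n⇒0<n∸m ∣w∣<v , large (ℕ.≰⇒> ∣w∣≰B)) ,
    ≈-trans (≈-reflexive w≡sd) (signed≈signed-complement s (ℕ.<⇒≤ ∣w∣<v))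

  record IsCirculant (B : ℕ) (Γ : Graph v) : Set where
    field
      difference⇒edge : ∀ {x y z} → 1 ℕ.≤ ∣ z ∣ → ∣ z ∣ ℕ.≤ B → toℤ y - toℤ x ≈ z → Γ x y
      edge⇒difference : ∀ {x y} → Γ x y → ∃[ z ] (1 ℕ.≤ ∣ z ∣ × ∣ z ∣ ℕ.≤ B) × toℤ y - toℤ x ≈ z

open Congruence using (mk≈)

toℤ-shift : ∀ {v} ⦃ _ : NonZero v ⦄ (x : Fin v) →
  let open Congruence v in toℤ (shift x) ≈ toℤ x ℤ.+ + 1
toℤ-shift {suc m} x with toℕ x ℕ.≟ m
... | yes x≡m = Congruence.≈-sym (suc m) (mk≈ (Div.divides (+ 1) (begin
  (+ toℕ x ℤ.+ + 1) - + 0 ≡⟨ ℤ.+-identityʳ _ ⟩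
  + toℕ x ℤ.+ + 1         ≡⟨ sym (ℤ.pos-+ (toℕ x) 1) ⟩
  + (toℕ x ℕ.+ 1)         ≡⟨ cong (λ i → + (i ℕ.+ 1)) x≡m ⟩
  + (m ℕ.+ 1)             ≡⟨ cong +_ (ℕ.+-comm m 1) ⟩
  + suc m                 ≡⟨ sym (ℤ.*-identityˡ _) ⟩
  + 1 ℤ.* + suc m         ∎)))
  where open ≡-Reasoning
toℤ-shift {suc zero}    Fin.zero | no 0≢0 = ⊥-elim (0≢0 refl)
toℤ-shift {suc (suc m)} x        | no _   = lowered
  where
  lowered : ∀ {p} → Congruence._≈_ (suc (suc m)) (+ suc (toℕ (Fin.lower₁ x p))) (+ toℕ x ℤ.+ + 1)
  lowered {p} = Congruence.≈-reflexive (suc (suc m))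
    (trans (cong +_ (trans (cong suc (Fin.toℕ-lower₁ x p)) (ℕ.+-comm 1 (toℕ x)))) (ℤ.pos-+ (toℕ x) 1))

nth : List ℤ → ℕ → ℤ
nth []       _       = + 0
nth (x ∷ xs) zero    = x
nth (x ∷ xs) (suc q) = nth xs q

All-nth : ∀ {P : ℤ → Set} {xs} → All P xs → ∀ {q} → q ℕ.< length xs → P (nth xs q)
All-nth (px ∷ _)   {zero}  _         = px
All-nth (_  ∷ pxs) {suc q} (s≤s q<n) = All-nth pxs q<n

AllPairs-nth : ∀ {R : ℤ → ℤ → Set} {xs} → AllPairs R xs →
  ∀ {p q} → p ℕ.< q → q ℕ.< length xs → R (nth xs p) (nth xs q)
AllPairs-nth (r ∷ _)  {zero}  {suc q} _         (s≤s q<n) = All-nth r q<n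
AllPairs-nth (_ ∷ rs) {suc p} {suc q} (s≤s p<q) (s≤s q<n) = AllPairs-nth rs p<q q<n

AllPairs-≢⇒nth-injective : ∀ {xs} → AllPairs _≢_ xs → ∀ {p q} → p ℕ.< length xs → q ℕ.< length xs →
  nth xs p ≡ nth xs q → p ≡ q
AllPairs-≢⇒nth-injective u {p} {q} p<n q<n eq with ℕ.<-cmp p q
... | tri< p<q _ _ = ⊥-elim (AllPairs-nth u p<q q<n eq)
... | tri≈ _ p≡q _ = p≡q
... | tri> _ _ q<p = ⊥-elim (AllPairs-nth u q<p p<n (sym eq))

module _ {X : Set} (f : X → Maybe ℤ) where

  nth-mapMaybe : ∀ xs {q} → q ℕ.< length (mapMaybe f xs) → ∃[ x ] f x ≡ just (nth (mapMaybe f xs) q)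
  nth-mapMaybe (x ∷ xs) {q} q<n with f x in fx
  nth-mapMaybe (x ∷ xs) {zero}  _         | just _ = x , fx
  nth-mapMaybe (x ∷ xs) {suc q} (s≤s q<n) | just _ = nth-mapMaybe xs q<n
  nth-mapMaybe (x ∷ xs) {q}     q<n       | nothing = nth-mapMaybe xs q<n

  module _ (f-injective : ∀ {x x' z} → f x ≡ just z → f x' ≡ just z → x ≡ x') where

    All-≢-mapMaybe : ∀ {x z} xs → f x ≡ just z → All (x ≢_) xs → All (z ≢_) (mapMaybe f xs)
    All-≢-mapMaybe []       fx []           = []
    All-≢-mapMaybe (y ∷ xs) fx (x≢y ∷ x≢xs) with f y in fy
    ... | just _  = (λ { refl → x≢y (f-injective fx fy) }) ∷ All-≢-mapMaybe xs fx x≢xs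
    ... | nothing = All-≢-mapMaybe xs fx x≢xs

    AllPairs-≢-mapMaybe : ∀ xs → AllPairs _≢_ xs → AllPairs _≢_ (mapMaybe f xs)
    AllPairs-≢-mapMaybe []       []           = []
    AllPairs-≢-mapMaybe (x ∷ xs) (x≢xs ∷ uxs) with f x in fx
    ... | just _  = All-≢-mapMaybe xs fx x≢xs ∷ AllPairs-≢-mapMaybe xs uxs
    ... | nothing = AllPairs-≢-mapMaybe xs uxs

length-partialSums : ∀ acc xs → length (partialSums acc xs) ≡ length xs
length-partialSums acc []       = refl
length-partialSums acc (x ∷ xs) = cong suc (length-partialSums (acc ℤ.+ x) xs)

partialSums-suc : ∀ acc xs {q} → suc q ℕ.< length xs →
  nth (partialSums acc xs) (suc q) ≡ nth (partialSums acc xs) q ℤ.+ nth xs (suc q)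
partialSums-suc acc (x ∷ [])     {zero}  (s≤s ())
partialSums-suc acc (x ∷ y ∷ xs) {zero}  _           = refl
partialSums-suc acc (x ∷ y ∷ xs) {suc q} (s≤s q<n)   = partialSums-suc (acc ℤ.+ x) (y ∷ xs) q<n

partialSums-last : ∀ acc x xs → nth (partialSums acc (x ∷ xs)) (length xs) ≡ acc ℤ.+ sumℤ (x ∷ xs)
partialSums-last acc x []       = cong (λ w → acc ℤ.+ w) (sym (ℤ.+-identityʳ x))
partialSums-last acc x (y ∷ xs) = trans (partialSums-last (acc ℤ.+ x) y xs) (ℤ.+-assoc acc x (sumℤ (y ∷ xs)))

partialSums-cyclic-step : ∀ {k} xs → length xs ≡ k → sumℤ xs ≡ + 0 → ∀ {i j} → j ℕ.< k →
  j ≡ suc i ⊎ (suc i ≡ k × j ≡ 0) →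
  nth (partialSums (+ 0) xs) j - nth (partialSums (+ 0) xs) i ≡ nth xs j
partialSums-cyclic-step xs refl _ {i} j<k (inj₁ refl) =
  trans (cong (λ s → s - nth (partialSums (+ 0) xs) i) (partialSums-suc (+ 0) xs j<k))
        (eq (nth (partialSums (+ 0) xs) i) _)
  where eq : ∀ a b → (a ℤ.+ b) - a ≡ b
        eq = solve-∀
partialSums-cyclic-step (x ∷ xs) refl Σ≡0 _ (inj₂ (refl , refl)) = begin
  (+ 0 ℤ.+ x) - nth (partialSums (+ 0) (x ∷ xs)) (length xs)
    ≡⟨ cong (λ s → (+ 0 ℤ.+ x) - s) (partialSums-last (+ 0) x xs) ⟩
  (+ 0 ℤ.+ x) - (+ 0 ℤ.+ sumℤ (x ∷ xs))
    ≡⟨ cong (λ s → (+ 0 ℤ.+ x) - (+ 0 ℤ.+ s)) Σ≡0 ⟩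
  (+ 0 ℤ.+ x) - (+ 0 ℤ.+ + 0)
    ≡⟨ eq x ⟩
  x ∎
  where
  open ≡-Reasoning
  eq : ∀ x → (+ 0 ℤ.+ x) - (+ 0 ℤ.+ + 0) ≡ x
  eq = solve-∀

zero-sum⇒3≤length : ∀ {k} xs → length xs ≡ k → 1 ℕ.≤ k → sumℤ xs ≡ + 0 →
  (∀ (j : Fin k) → nth xs (toℕ j) ≢ + 0) →
  (∀ (j j' : Fin k) → ∣ nth xs (toℕ j) ∣ ≡ ∣ nth xs (toℕ j') ∣ → j ≡ j') → 3 ℕ.≤ k
zero-sum⇒3≤length (x ∷ []) refl _ Σ≡0 nonzero _ =
  ⊥-elim (nonzero Fin.zero (trans (sym (ℤ.+-identityʳ x)) Σ≡0))
zero-sum⇒3≤length (x ∷ y ∷ []) refl _ Σ≡0 _ distinct =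
  ⊥-elim (Fin.0≢1+n (sym (distinct (Fin.suc Fin.zero) Fin.zero ∣y∣≡∣x∣)))
  where
  eq : ∀ x y → y ≡ - x ℤ.+ (x ℤ.+ (y ℤ.+ + 0))
  eq = solve-∀
  ∣y∣≡∣x∣ : ∣ y ∣ ≡ ∣ x ∣
  ∣y∣≡∣x∣ = trans (cong ∣_∣ (trans (eq x y) (trans (cong (λ s → - x ℤ.+ s) Σ≡0) (ℤ.+-identityʳ (- x)))))
                  (ℤ.∣-i∣≡∣i∣ x)
zero-sum⇒3≤length (x ∷ y ∷ z ∷ xs) refl _ _ _ _ = s≤s (s≤s (s≤s z≤n))

IsNext-injective : ∀ {k} {i i' j : Fin k} → IsNext i j → IsNext i' j → i ≡ i'
IsNext-injective (inj₁ j≡1+i) (inj₁ j≡1+i') = Fin.toℕ-injective (ℕ.suc-injective (trans (sym j≡1+i) j≡1+i'))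
IsNext-injective (inj₁ j≡1+i) (inj₂ (_ , j≡0)) with () ← trans (sym j≡1+i) j≡0
IsNext-injective (inj₂ (_ , j≡0)) (inj₁ j≡1+i') with () ← trans (sym j≡1+i') j≡0
IsNext-injective (inj₂ (1+i≡k , _)) (inj₂ (1+i'≡k , _)) =
  Fin.toℕ-injective (ℕ.suc-injective (trans 1+i≡k (sym 1+i'≡k)))

IsNext-predecessor : ∀ {k} (j : Fin k) → ∃[ i ] IsNext i j
IsNext-predecessor {suc k} j with toℕ j in j≡
... | zero  = Fin.fromℕ k , inj₂ (cong suc (Fin.toℕ-fromℕ k) , refl)
... | suc q = fromℕ< q<k , inj₁ (cong suc (sym (Fin.toℕ-fromℕ< q<k)))
  where q<k : q ℕ.< suc k
        q<k = ℕ.<-trans (ℕ.n<1+n q) (subst (ℕ._< suc k) j≡ (Fin.toℕ<n j))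

Fin-injective⇒surjective : ∀ {m} (f : Fin m → Fin m) → (∀ {a b} → f a ≡ f b → a ≡ b) → ∀ d → ∃[ a ] f a ≡ d
Fin-injective⇒surjective {suc m} f f-inj d with Fin.any? (λ a → f a Fin.≟ d)
... | yes hit = hit
... | no miss
  with a , b , a<b , eq ← Fin.pigeonhole (ℕ.n<1+n m) (λ a → Fin.punchOut {i = d} {j = f a} (λ e → miss (a , sym e)))
  = ⊥-elim (Fin.<⇒≢ a<b (f-inj (Fin.punchOut-injective {i = d} _ _ eq)))

module Development (v : ℕ) ⦃ _ : NonZero v ⦄ {N k : ℕ} (3≤k : 3 ℕ.≤ k)
  (L : Fin N → List ℤ) (length-L : ∀ r → length (L r) ≡ k) (sum-L : ∀ r → sumℤ (L r) ≡ + 0)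
  (L-simple : ∀ r → SimpleMod v (L r)) where
  open import Data.Integer using (_+_)
  open Congruence v

  entry : Fin N → Fin k → ℤ
  entry r j = nth (L r) (toℕ j)

  partial : Fin N → ℕ → ℤ
  partial r = nth (partialSums (+ 0) (L r))

  <k⇒<length-partialSums : ∀ r {q} → q ℕ.< k → q ℕ.< length (partialSums (+ 0) (L r))
  <k⇒<length-partialSums r = subst (_ ℕ.<_) (sym (trans (length-partialSums (+ 0) (L r)) (length-L r)))

  partial-injective : ∀ r {p p'} → p ℕ.< k → p' ℕ.< k → partial r p ≈ partial r p' → p ≡ p'
  partial-injective r {p} {p'} p<k p'<k P≈P' with ℕ.<-cmp p p'
  ... | tri< p<p' _ _ =
    ⊥-elim (AllPairs-nth (L-simple r) p<p' (<k⇒<length-partialSums r p'<k) (Div.∣⇒∣ᵤ (divides P≈P')))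
  ... | tri≈ _ p≡p' _ = p≡p'
  ... | tri> _ _ p'<p =
    ⊥-elim (AllPairs-nth (L-simple r) p'<p (<k⇒<length-partialSums r p<k) (Div.∣⇒∣ᵤ (divides (≈-sym P≈P'))))

  vertex : Fin N → Fin v → Fin k → Fin v
  vertex r t p = fromℤ (toℤ t + partial r (toℕ p))

  toℤ-vertex : ∀ r t p → toℤ (vertex r t p) ≈ toℤ t + partial r (toℕ p)
  toℤ-vertex r t p = toℤ-fromℤ _

  vertex-injective : ∀ r t {p p'} → vertex r t p ≡ vertex r t p' → p ≡ p'
  vertex-injective r t {p} {p'} eq = Fin.toℕ-injective (partial-injective r (Fin.toℕ<n p) (Fin.toℕ<n p')
    (≈-cancelˡ (toℤ t) (≈-trans (≈-sym (toℤ-vertex r t p))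
                                 (≈-trans (≈-reflexive (cong toℤ eq)) (toℤ-vertex r t p')))))

  translate : Fin N → Fin v → Cycle k v
  translate r t = record { three≤k = 3≤k ; vert = vertex r t ; inj = λ _ _ → vertex-injective r t }

  vertex-translation-injective : ∀ r {t t'} p → vertex r t p ≡ vertex r t' p → t ≡ t'
  vertex-translation-injective r p eq = toℤ-injective (≈-cancelʳ (partial r (toℕ p))
    (≈-trans (≈-sym (toℤ-vertex r _ p)) (≈-trans (≈-reflexive (cong toℤ eq)) (toℤ-vertex r _ p))))

  edge-difference : ∀ r t {i j} → IsNext i j → toℤ (vertex r t j) - toℤ (vertex r t i) ≈ entry r j
  edge-difference r t {i} {j} next = ≈-trans (≈-- (toℤ-vertex r t j) (toℤ-vertex r t i)) (≈-reflexive (begin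
    (toℤ t + partial r (toℕ j)) - (toℤ t + partial r (toℕ i))
      ≡⟨ eq (toℤ t) (partial r (toℕ j)) (partial r (toℕ i)) ⟩
    partial r (toℕ j) - partial r (toℕ i)
      ≡⟨ partialSums-cyclic-step (L r) (length-L r) (sum-L r) (Fin.toℕ<n j) next ⟩
    entry r j ∎))
    where
    open ≡-Reasoning
    eq : ∀ c a b → (c + a) - (c + b) ≡ a - b
    eq = solve-∀

  record EdgeData (r : Fin N) (t : Fin v) (x y : Fin v) : Set where
    field
      {i j}      : Fin k
      next       : IsNext i j
      forward    : Bool
      difference : toℤ y - toℤ x ≈ signed forward (entry r j)
      start      : vertex r t i ≡ (if forward then x else y)

  edgeData : ∀ {r t x y} → HasEdge (translate r t) x y → EdgeData r t x y
  edgeData {r} {t} (i , j , next , inj₁ (refl , refl)) = record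
    { next = next ; forward = true ; difference = edge-difference r t next ; start = refl }
  edgeData {r} {t} (i , j , next , inj₂ (refl , refl)) = record
    { next = next ; forward = false ; start = refl
    ; difference = ≈-trans (≈-reflexive (eq (toℤ (vertex r t i)) (toℤ (vertex r t j))))
                           (≈-neg (edge-difference r t next)) }
    where eq : ∀ a b → a - b ≡ - (b - a)
          eq = solve-∀

  edgeData-position : ∀ {r t x y} (h : HasEdge (translate r t) x y) → EdgeData.j (edgeData h) ≡ proj₁ (proj₂ h)
  edgeData-position (_ , _ , _ , inj₁ (refl , refl)) = refl
  edgeData-position (_ , _ , _ , inj₂ (refl , refl)) = refl

  same-position⇒same-edge : ∀ {r t x y x' y'} (h : HasEdge (translate r t) x y) (h' : HasEdge (translate r t) x' y') →
    proj₁ (proj₂ h) ≡ proj₁ (proj₂ h') → (x ≡ x' × y ≡ y') ⊎ (x ≡ y' × y ≡ x')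
  same-position⇒same-edge (i , j , next , o) (i' , .j , next' , o') refl
    with refl ← IsNext-injective next next' with o | o'
  ... | inj₁ (refl , refl) | inj₁ (refl , refl) = inj₁ (refl , refl)
  ... | inj₁ (refl , refl) | inj₂ (refl , refl) = inj₂ (refl , refl)
  ... | inj₂ (refl , refl) | inj₁ (refl , refl) = inj₂ (refl , refl)
  ... | inj₂ (refl , refl) | inj₂ (refl , refl) = inj₁ (refl , refl)

  translate-forward : ∀ r {i j} → IsNext i j → ∀ x y → toℤ y - toℤ x ≈ entry r j →
    ∃[ t ] vertex r t i ≡ x × vertex r t j ≡ y
  translate-forward r {i} {j} next x y diff = t , start , finish
    where
    t = fromℤ (toℤ x - partial r (toℕ i))
    eq₁ : ∀ a b → (a - b) + b ≡ a
    eq₁ = solve-∀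
    eq₂ : ∀ a b → a ≡ (a - b) + b
    eq₂ = solve-∀
    start : vertex r t i ≡ x
    start = toℤ-injective (≈-trans (toℤ-vertex r t i)
      (≈-trans (≈-+ (toℤ-fromℤ (toℤ x - partial r (toℕ i))) ≈-refl) (≈-reflexive (eq₁ (toℤ x) (partial r (toℕ i))))))
    finish : vertex r t j ≡ y
    finish = toℤ-injective
      (≈-trans (≈-reflexive (eq₂ (toℤ (vertex r t j)) (toℤ (vertex r t i))))
      (≈-trans (≈-+ (edge-difference r t next) (≈-reflexive (cong toℤ start)))
      (≈-trans (≈-+ (≈-sym diff) ≈-refl) (≈-reflexive (sym (eq₂ (toℤ y) (toℤ x)))))))

  translate-through : ∀ r {i j} → IsNext i j → ∀ s x y → toℤ y - toℤ x ≈ signed s (entry r j) →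
    ∃[ t ] HasEdge (translate r t) x y × vertex r t i ≡ (if s then x else y)
  translate-through r next true x y diff =
    let t , start , finish = translate-forward r next x y diff
    in t , (_ , _ , next , inj₁ (start , finish)) , start
  translate-through r next false x y diff =
    let t , start , finish = translate-forward r next y x (b-a≈-c⇒a-b≈c {toℤ x} {toℤ y} diff)
    in t , (_ , _ , next , inj₂ (start , finish)) , start

  vertex-shift : ∀ r t p → vertex r (shift t) p ≡ shift (vertex r t p)
  vertex-shift r t p = toℤ-injective
    (≈-trans (toℤ-vertex r (shift t) p)
    (≈-trans (≈-+ (toℤ-shift t) (≈-refl {partial r (toℕ p)}))
    (≈-trans (≈-reflexive (eq (toℤ t) (partial r (toℕ p))))
    (≈-sym (≈-trans (toℤ-shift (vertex r t p)) (≈-+ (toℤ-vertex r t p) (≈-refl {+ 1})))))))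
    where eq : ∀ a b → (a + + 1) + b ≡ (a + b) + + 1
          eq = solve-∀

  shift-injective : ∀ {x y : Fin v} → shift x ≡ shift y → x ≡ y
  shift-injective {x} {y} eq = toℤ-injective (≈-cancelʳ (+ 1)
    (≈-trans (≈-sym (toℤ-shift x)) (≈-trans (≈-reflexive (cong toℤ eq)) (toℤ-shift y))))

  vertex-unshift : ∀ r t p {x} → vertex r (shift t) p ≡ shift x → vertex r t p ≡ x
  vertex-unshift r t p eq = shift-injective (trans (sym (vertex-shift r t p)) eq)

  HasEdge-shift⁺ : ∀ {r t x y} → HasEdge (translate r t) x y → HasEdge (translate r (shift t)) (shift x) (shift y)
  HasEdge-shift⁺ {r} {t} (i , j , next , inj₁ (refl , refl)) =
    i , j , next , inj₁ (vertex-shift r t i , vertex-shift r t j)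
  HasEdge-shift⁺ {r} {t} (i , j , next , inj₂ (refl , refl)) =
    i , j , next , inj₂ (vertex-shift r t i , vertex-shift r t j)

  HasEdge-shift⁻ : ∀ {r t x y} → HasEdge (translate r (shift t)) (shift x) (shift y) → HasEdge (translate r t) x y
  HasEdge-shift⁻ {r} {t} (i , j , next , inj₁ (eᵢ , eⱼ)) =
    i , j , next , inj₁ (vertex-unshift r t i eᵢ , vertex-unshift r t j eⱼ)
  HasEdge-shift⁻ {r} {t} (i , j , next , inj₂ (eᵢ , eⱼ)) =
    i , j , next , inj₂ (vertex-unshift r t i eᵢ , vertex-unshift r t j eⱼ)

  translates : Fin (N ℕ.* v) → Cycle k v
  translates I = translate (proj₁ (remQuot {N} v I)) (proj₂ (remQuot {N} v I))

  HasEdge-translates⁺ : ∀ {r t x y} → HasEdge (translate r t) x y → HasEdge (translates (combine r t)) x y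
  HasEdge-translates⁺ {x = x} {y} = subst (λ (r , t) → HasEdge (translate r t) x y) (sym (Fin.remQuot-combine _ _))

  HasEdge-translates⁻ : ∀ {r t x y} → HasEdge (translates (combine r t)) x y → HasEdge (translate r t) x y
  HasEdge-translates⁻ {x = x} {y} = subst (λ (r , t) → HasEdge (translate r t) x y) (Fin.remQuot-combine _ _)

  translates-shift : ∀ I → ∃[ J ] ∀ x y → HasEdge (translates I) x y ⇔ HasEdge (translates J) (shift x) (shift y)
  translates-shift I = combine r (shift t) , λ x y →
    mk⇔ (λ h → HasEdge-translates⁺ (HasEdge-shift⁺ h)) (λ h → HasEdge-shift⁻ (HasEdge-translates⁻ h))
    where r = proj₁ (remQuot {N} v I)
          t = proj₂ (remQuot {N} v I)

  module Decompose (Γ : Graph v)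
    (entry⇒edge : ∀ {x y r j} s → toℤ y - toℤ x ≈ signed s (entry r j) → Γ x y)
    (edge⇒entry : ∀ {x y} → Γ x y → ∃[ r ] ∃[ j ] ∃[ s ] toℤ y - toℤ x ≈ signed s (entry r j))
    (entry-unique : ∀ {r j r' j'} s s' → signed s (entry r j) ≈ signed s' (entry r' j') →
                    r ≡ r' × j ≡ j' × s ≡ s') where

    translates-sound : ∀ I x y → HasEdge (translates I) x y → Γ x y
    translates-sound I x y h = entry⇒edge forward difference
      where open EdgeData (edgeData {proj₁ (remQuot {N} v I)} {proj₂ (remQuot {N} v I)} h)

    edge-translate-unique : ∀ {r t i j x y} s → IsNext i j → toℤ y - toℤ x ≈ signed s (entry r j) →
      vertex r t i ≡ (if s then x else y) → ∀ {r' t'} → HasEdge (translate r' t') x y → r' ≡ r × t' ≡ t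
    edge-translate-unique {r} {t} {i} {j} s next diff start h
      with record { next = next' ; forward = s' ; difference = diff' ; start = start' } ← edgeData h
      with refl , refl , refl ← entry-unique s s' (≈-trans (≈-sym diff) diff')
      with refl ← IsNext-injective next next'
      = refl , sym (vertex-translation-injective r i (trans start (sym start')))

    translates-cover : ∀ x y → Γ x y → ∃[ I ] HasEdge (translates I) x y × (∀ J → HasEdge (translates J) x y → J ≡ I)
    translates-cover x y xy
      with r , j , s , diff ← edge⇒entry xy
      with i , next ← IsNext-predecessor j
      with t , h , start ← translate-through r next s x y diff
      = combine r t , HasEdge-translates⁺ h , λ J hJ →
          let r'≡r , t'≡t = edge-translate-unique s next diff start hJ
          in trans (sym (Fin.combine-remQuot {N} v J)) (cong₂ combine r'≡r t'≡t)

    decomposition : Decomposition k Γ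
    decomposition = record { size = N ℕ.* v ; cyc = translates ; sound = translates-sound ; cover = translates-cover }

    decomposition-cyclic : Cyclic decomposition
    decomposition-cyclic = translates-shift

K-isCirculant : ∀ {B v} ⦃ _ : NonZero v ⦄ → v ≡ suc (B ℕ.+ B) → Congruence.IsCirculant v B (K v)
K-isCirculant {B} refl = record
  { difference⇒edge = λ 1≤∣z∣ ∣z∣≤B → ≈-nonzero⇒≢ 1≤∣z∣ (s≤s (ℕ.≤-trans ∣z∣≤B (ℕ.m≤m+n B B)))
  ; edge⇒difference = λ {x} {y} x≢y → ≈-representative-≤ (toℤ y - toℤ x) (1≤∣toℤ-toℤ∣ x≢y) (∣toℤ-toℤ∣<v y x)
      λ B<d → ℕ.≤-trans (ℕ.∸-monoʳ-≤ (suc (B ℕ.+ B)) B<d) (ℕ.≤-reflexive (ℕ.m+n∸m≡n B B))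
  }
  where open Congruence (suc (B ℕ.+ B))

K-I-isCirculant : ∀ {B t} ⦃ _ : NonZero (2 ℕ.* t) ⦄ → t ≡ suc B → Congruence.IsCirculant (2 ℕ.* t) B (K-I t)
K-I-isCirculant {B} {t} refl = record
  { difference⇒edge = λ {x} {y} 1≤∣z∣ ∣z∣≤B y-x≈z →
      ≈-nonzero⇒≢ 1≤∣z∣ (ℕ.<-≤-trans (s≤s ∣z∣≤B) (ℕ.m≤m+n t _)) y-x≈z ,
      (λ x≡y+t → not-antipodal ∣z∣≤B (≈-sym y-x≈z) (trans (ℤ.∣i-j∣≡∣j-i∣ (toℤ y) (toℤ x))
                   (subst (λ a → ∣ + a - toℤ y ∣ ≡ t) (sym x≡y+t) (∣+[a+d]-+a∣≡d (toℕ y) t)))) ,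
      (λ y≡x+t → not-antipodal ∣z∣≤B (≈-sym y-x≈z)
                   (subst (λ a → ∣ + a - toℤ x ∣ ≡ t) (sym y≡x+t) (∣+[a+d]-+a∣≡d (toℕ x) t)))
  ; edge⇒difference = λ {x} {y} (x≢y , x≢y+t , y≢x+t) →
      ≈-representative-≤ (toℤ y - toℤ x) (1≤∣toℤ-toℤ∣ x≢y) (∣toℤ-toℤ∣<v y x) λ B<d →
        complement-≤ B<d (∣toℤ-toℤ∣<v y x) (λ d≡t → [ y≢x+t , x≢y+t ]′ (∣+a-+b∣≡d⇒ (toℕ y) (toℕ x) d≡t))
  }
  where
  open Congruence (2 ℕ.* t)
  v≡t+t : 2 ℕ.* t ≡ t ℕ.+ t
  v≡t+t = cong (t ℕ.+_) (ℕ.+-identityʳ t)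

  not-antipodal : ∀ {z w} → ∣ z ∣ ℕ.≤ B → z ≈ w → ∣ w ∣ ≢ t
  not-antipodal {z} {w} ∣z∣≤B z≈w ∣w∣≡t = ℕ.<-irrefl (trans (cong ∣_∣ (≈-close⇒≡ z≈w small)) ∣w∣≡t) (s≤s ∣z∣≤B)
    where small : ∣ z ∣ ℕ.+ ∣ w ∣ ℕ.< 2 ℕ.* t
          small = subst₂ (λ a m → ∣ z ∣ ℕ.+ a ℕ.< m) (sym ∣w∣≡t) (sym v≡t+t) (ℕ.+-monoˡ-< t (s≤s ∣z∣≤B))

  complement-≤ : ∀ {d} → B ℕ.< d → d ℕ.< 2 ℕ.* t → d ≢ t → 2 ℕ.* t ℕ.∸ d ℕ.≤ B
  complement-≤ {d} B<d d<v d≢t = subst (λ m → m ℕ.∸ d ℕ.≤ B) (sym v≡t+t) (ℕ.≤-pred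
    (subst (t ℕ.+ t ℕ.∸ d ℕ.<_) (ℕ.m+n∸m≡n t t)
      (ℕ.∸-monoʳ-< (ℕ.≤∧≢⇒< B<d (d≢t ∘ sym)) (ℕ.<⇒≤ (subst (d ℕ.<_) v≡t+t d<v)))))

-- row (transpose A) j is col A j by definition, so every fact about rows also covers columns
transpose : ∀ {n} → Array n → Array n
transpose A i j = A j i

transpose-IsHeffter : ∀ {n k A} → IsHeffter n k A → IsHeffter n k (transpose A)
transpose-IsHeffter H = record
  { entries     = λ i j → entries j i
  ; absDistinct = λ i j i' j' z z' e e' eq → swap (absDistinct j i j' i' z z' e e' eq)
  ; rowSize     = colSize
  ; colSize     = rowSize
  ; rowSum      = colSum
  ; colSum      = rowSum
  }
  where open IsHeffter H

module Rows {n k} {A : Array n} (H : IsHeffter n k A) where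
  open IsHeffter H

  entry : Fin n → Fin k → ℤ
  entry i j = nth (row A i) (toℕ j)

  private
    <k⇒<length : ∀ i {q} → q ℕ.< k → q ℕ.< length (row A i)
    <k⇒<length i = subst (_ ℕ.<_) (sym (rowSize i))

  entry-cell : ∀ i j → ∃[ c ] A i c ≡ just (entry i j)
  entry-cell i j = nth-mapMaybe (A i) (allFin n) (<k⇒<length i (Fin.toℕ<n j))

  entry-injective : ∀ {i j j'} → entry i j ≡ entry i j' → j ≡ j'
  entry-injective {i} {j} {j'} eq = Fin.toℕ-injective (AllPairs-≢⇒nth-injective
    (AllPairs-≢-mapMaybe (A i) (λ e e' → proj₂ (absDistinct i _ i _ _ _ e e' refl)) (allFin n) (allFin⁺ n))
    (<k⇒<length i (Fin.toℕ<n j)) (<k⇒<length i (Fin.toℕ<n j')) eq)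

  1≤∣entry∣≤nk : ∀ i j → 1 ℕ.≤ ∣ entry i j ∣ × ∣ entry i j ∣ ℕ.≤ n ℕ.* k
  1≤∣entry∣≤nk i j = entries i _ _ (proj₂ (entry-cell i j))

  ∣entry∣-injective : ∀ {i j i' j'} → ∣ entry i j ∣ ≡ ∣ entry i' j' ∣ → i ≡ i' × j ≡ j'
  ∣entry∣-injective {i} {j} {i'} {j'} eq
    with c , cell ← entry-cell i j | c' , cell' ← entry-cell i' j'
    with refl , refl ← absDistinct i c i' c' _ _ cell cell' eq
    = refl , entry-injective (Maybe.just-injective (trans (sym cell) cell'))

  private
    pred< : ∀ {a} → 1 ℕ.≤ a → a ℕ.≤ n ℕ.* k → ℕ.pred a ℕ.< n ℕ.* k
    pred< (s≤s _) a≤nk = a≤nk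

    ∣entry∣-1 : Fin (n ℕ.* k) → Fin (n ℕ.* k)
    ∣entry∣-1 I = let i , j = remQuot {n} k I in fromℕ< (pred< (proj₁ (1≤∣entry∣≤nk i j)) (proj₂ (1≤∣entry∣≤nk i j)))

    toℕ-∣entry∣-1 : ∀ I → suc (toℕ (∣entry∣-1 I)) ≡ ∣ entry (proj₁ (remQuot {n} k I)) (proj₂ (remQuot {n} k I)) ∣
    toℕ-∣entry∣-1 I = let i , j = remQuot {n} k I in
      trans (cong suc (Fin.toℕ-fromℕ< _)) (ℕ.suc-pred _ ⦃ ℕ.>-nonZero (proj₁ (1≤∣entry∣≤nk i j)) ⦄)

    ∣entry∣-1-injective : ∀ {I J} → ∣entry∣-1 I ≡ ∣entry∣-1 J → I ≡ J
    ∣entry∣-1-injective {I} {J} eq =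
      let i≡i' , j≡j' = ∣entry∣-injective
                          (trans (sym (toℕ-∣entry∣-1 I)) (trans (cong (suc ∘ toℕ) eq) (toℕ-∣entry∣-1 J)))
      in trans (sym (Fin.combine-remQuot {n} k I)) (trans (cong₂ combine i≡i' j≡j') (Fin.combine-remQuot {n} k J))

  -- I ↦ ∣ entry ∣ − 1 is an injective self-map of Fin (n · k), hence onto
  ∣entry∣-surjective : ∀ {d} → 1 ℕ.≤ d → d ℕ.≤ n ℕ.* k → ∃[ i ] ∃[ j ] ∣ entry i j ∣ ≡ d
  ∣entry∣-surjective {suc d} (s≤s _) d<nk =
    let I , eq = Fin-injective⇒surjective ∣entry∣-1 ∣entry∣-1-injective (fromℕ< d<nk)
    in proj₁ (remQuot {n} k I) , proj₂ (remQuot {n} k I) ,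
       trans (sym (toℕ-∣entry∣-1 I)) (cong suc (trans (cong toℕ eq) (Fin.toℕ-fromℕ< d<nk)))

  module _ (v : ℕ) ⦃ _ : NonZero v ⦄ (2nk<v : n ℕ.* k ℕ.+ n ℕ.* k ℕ.< v) where
    open Congruence v

    private
      ∣signed-cell∣≤nk : ∀ s {i c z} → A i c ≡ just z → ∣ signed s z ∣ ℕ.≤ n ℕ.* k
      ∣signed-cell∣≤nk s {z = z} cell = subst (ℕ._≤ _) (sym (∣signed∣ s z)) (proj₂ (entries _ _ _ cell))

      cell≢0 : ∀ {i c z} → A i c ≡ just z → z ≢ + 0
      cell≢0 cell refl with () ← proj₁ (entries _ _ _ cell)

      same-cell : ∀ {i c i' c' z w} → i ≡ i' → c ≡ c' → A i c ≡ just z → A i' c' ≡ just w → z ≡ w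
      same-cell refl refl cell cell' = Maybe.just-injective (trans (sym cell) cell')

    signed-cell-injective : ∀ {i c i' c' z w} s s' → A i c ≡ just z → A i' c' ≡ just w →
      signed s z ≈ signed s' w → i ≡ i' × c ≡ c' × z ≡ w × s ≡ s'
    signed-cell-injective {i} {c} {i'} {c'} {z} {w} s s' cell cell' sz≈s'w =
      let sz≡s'w = ≈-close⇒≡ sz≈s'w
                     (ℕ.≤-<-trans (ℕ.+-mono-≤ (∣signed-cell∣≤nk s cell) (∣signed-cell∣≤nk s' cell')) 2nk<v)
          i≡i' , c≡c' = absDistinct i c i' c' z w cell cell'
                          (trans (sym (∣signed∣ s z)) (trans (cong ∣_∣ sz≡s'w) (∣signed∣ s' w)))
          z≡w = same-cell i≡i' c≡c' cell cell'
      in i≡i' , c≡c' , z≡w , signed-injective s s' (cell≢0 cell) (trans sz≡s'w (cong (signed s') (sym z≡w)))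

    signed-entry-injective : ∀ {i j i' j'} s s' → signed s (entry i j) ≈ signed s' (entry i' j') →
      i ≡ i' × j ≡ j' × s ≡ s'
    signed-entry-injective {i} {j} {i'} {j'} s s' eq
      with refl , _ , z≡w , refl ← signed-cell-injective s s' (proj₂ (entry-cell i j)) (proj₂ (entry-cell i' j')) eq
      = refl , entry-injective z≡w , refl

    signed-entry-surjective : ∀ {z} → 1 ℕ.≤ ∣ z ∣ → ∣ z ∣ ℕ.≤ n ℕ.* k → ∃[ i ] ∃[ j ] ∃[ s ] z ≡ signed s (entry i j)
    signed-entry-surjective 1≤∣z∣ ∣z∣≤nk with i , j , ∣e∣≡∣z∣ ← ∣entry∣-surjective 1≤∣z∣ ∣z∣≤nk =
      i , j , ∣∣≡⇒signed (entry i j) _ ∣e∣≡∣z∣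

IsHeffter⇒3≤k : ∀ {n k A} → IsHeffter n k A → 1 ℕ.≤ n → 1 ℕ.≤ k → 3 ℕ.≤ k
IsHeffter⇒3≤k {n} {k} {A} H 1≤n 1≤k = zero-sum⇒3≤length (row A i) (rowSize i) 1≤k (rowSum i)
  (λ j e≡0 → ℕ.1+n≰n (subst (λ e → 1 ℕ.≤ ∣ e ∣) e≡0 (proj₁ (1≤∣entry∣≤nk i j))))
  (λ j j' eq → proj₂ (∣entry∣-injective eq))
  where
  open IsHeffter H
  open Rows H
  i = Fin.fromℕ< 1≤n

module RowDecomposition {n k} {A : Array n} (H : IsHeffter n k A) (3≤k : 3 ℕ.≤ k)
  (v : ℕ) ⦃ _ : NonZero v ⦄ (2nk<v : n ℕ.* k ℕ.+ n ℕ.* k ℕ.< v) (rows-simple : ∀ i → SimpleMod v (row A i))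
  {Γ : Graph v} (Γ-circulant : Congruence.IsCirculant v (n ℕ.* k) Γ) where
  open IsHeffter H
  open Rows H using (1≤∣entry∣≤nk; signed-entry-injective; signed-entry-surjective)
  open Congruence v
  open IsCirculant Γ-circulant
  open Development v 3≤k (row A) rowSize rowSum rows-simple public

  private
    ∣signed-entry∣ : ∀ s i j → 1 ℕ.≤ ∣ signed s (entry i j) ∣ × ∣ signed s (entry i j) ∣ ℕ.≤ n ℕ.* k
    ∣signed-entry∣ s i j rewrite ∣signed∣ s (entry i j) = 1≤∣entry∣≤nk i j

    entry⇒edge : ∀ {x y i j} s → toℤ y - toℤ x ≈ signed s (entry i j) → Γ x y
    entry⇒edge {i = i} {j} s diff = difference⇒edge (proj₁ (∣signed-entry∣ s i j)) (proj₂ (∣signed-entry∣ s i j)) diff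

    edge⇒entry : ∀ {x y} → Γ x y → ∃[ i ] ∃[ j ] ∃[ s ] toℤ y - toℤ x ≈ signed s (entry i j)
    edge⇒entry xy =
      let z , (1≤∣z∣ , ∣z∣≤nk) , diff = edge⇒difference xy
          i , j , s , z≡se = signed-entry-surjective v 2nk<v 1≤∣z∣ ∣z∣≤nk
      in i , j , s , ≈-trans diff (≈-reflexive z≡se)

  open Decompose Γ entry⇒edge edge⇒entry (signed-entry-injective v 2nk<v) public

module RowColumnDecompositions {n k} {A : Array n} (H : IsHeffter n k A) (3≤k : 3 ℕ.≤ k)
  (v : ℕ) ⦃ _ : NonZero v ⦄ (2nk<v : n ℕ.* k ℕ.+ n ℕ.* k ℕ.< v)
  (rows-simple : ∀ i → SimpleMod v (row A i)) (cols-simple : ∀ j → SimpleMod v (col A j))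
  {Γ : Graph v} (Γ-circulant : Congruence.IsCirculant v (n ℕ.* k) Γ) where
  open Congruence v
  module R = RowDecomposition H 3≤k v 2nk<v rows-simple Γ-circulant
  module C = RowDecomposition (transpose-IsHeffter H) 3≤k v 2nk<v cols-simple Γ-circulant

  shared-edge-cell : ∀ {r t c t' x y} (h : HasEdge (R.translate r t) x y) → HasEdge (C.translate c t') x y →
    A r c ≡ just (R.entry r (proj₁ (proj₂ h)))
  shared-edge-cell {r} {t} {c} {t'} h h' =
    let open R.EdgeData (R.edgeData h) using (j; forward; difference)
        open C.EdgeData (C.edgeData h') renaming (j to j'; forward to forward'; difference to difference')
        c₁ , cell₁ = Rows.entry-cell H r j
        r₂ , cell₂ = Rows.entry-cell (transpose-IsHeffter H) c j'
        _ , c₁≡c , _ = Rows.signed-cell-injective H v 2nk<v forward forward' cell₁ cell₂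
                         (≈-trans (≈-sym difference) difference')
    in subst₂ (λ c j → A r c ≡ just (R.entry r j)) c₁≡c (R.edgeData-position h) cell₁

  rows-columns-orthogonal : Orthogonal R.decomposition C.decomposition
  rows-columns-orthogonal I J x y x' y' h₁ h₂ h₃ h₄ = R.same-position⇒same-edge h₁ h₃
    (Rows.entry-injective H (Maybe.just-injective (trans (sym (shared-edge-cell h₁ h₂)) (shared-edge-cell h₃ h₄))))

  orthogonal-pair : OrthCyclicPair k Γ
  orthogonal-pair =
    R.decomposition , C.decomposition , R.decomposition-cyclic , C.decomposition-cyclic , rows-columns-orthogonal

SHStar⇒orthogonal-K : ∀ {n k} (SH : SHStar n k) → 3 ℕ.≤ k → OrthCyclicPair k (K (suc (2 ℕ.* n ℕ.* k)))
SHStar⇒orthogonal-K {n} {k} SH 3≤k = RowColumnDecompositions.orthogonal-pair heffter 3≤k (suc (2 ℕ.* n ℕ.* k))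
  (subst (n ℕ.* k ℕ.+ n ℕ.* k ℕ.<_) (cong suc (sym (2mn≡mn+mn n k))) (ℕ.n<1+n _))
  rowSimple₁ colSimple₁ (K-isCirculant (cong suc (2mn≡mn+mn n k)))
  where
  open SHStar SH
  2mn≡mn+mn : ∀ m n → 2 ℕ.* m ℕ.* n ≡ m ℕ.* n ℕ.+ m ℕ.* n
  2mn≡mn+mn = ℕ-Solver.solve-∀

SHStar⇒orthogonal-K-I : ∀ {n k} (SH : SHStar n k) → 3 ℕ.≤ k → OrthCyclicPair k (K-I (n ℕ.* k ℕ.+ 1))
SHStar⇒orthogonal-K-I {n} {k} SH 3≤k = RowColumnDecompositions.orthogonal-pair heffter 3≤k v ⦃ v-nonZero ⦄
  (subst (n ℕ.* k ℕ.+ n ℕ.* k ℕ.<_) (sym (v≡1+mn+1+mn n k)) (s≤s (ℕ.+-monoʳ-≤ (n ℕ.* k) (ℕ.n≤1+n _))))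
  (λ i → subst (λ v → SimpleMod v (row array i)) (2+2mn≡v n k) (rowSimple₂ i))
  (λ j → subst (λ v → SimpleMod v (col array j)) (2+2mn≡v n k) (colSimple₂ j))
  (K-I-isCirculant ⦃ v-nonZero ⦄ (ℕ.+-comm (n ℕ.* k) 1))
  where
  open SHStar SH
  v = 2 ℕ.* (n ℕ.* k ℕ.+ 1)
  v-nonZero : NonZero v
  v-nonZero = ℕ.>-nonZero (ℕ.≤-trans (ℕ.m≤n+m 1 (n ℕ.* k)) (ℕ.m≤m+n (n ℕ.* k ℕ.+ 1) _))
  2+2mn≡v : ∀ m n → 2 ℕ.+ 2 ℕ.* m ℕ.* n ≡ 2 ℕ.* (m ℕ.* n ℕ.+ 1)
  2+2mn≡v = ℕ-Solver.solve-∀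
  v≡1+mn+1+mn : ∀ m n → 2 ℕ.* (m ℕ.* n ℕ.+ 1) ≡ suc (m ℕ.* n ℕ.+ suc (m ℕ.* n))
  v≡1+mn+1+mn = ℕ-Solver.solve-∀

open import Data.Nat using (_≤_; _+_; _*_)

proposition2p7 : (n k : ℕ) → 1 ≤ n → 1 ≤ k → SHStar n k →
    OrthCyclicPair k (K (suc (2 * n * k))) × OrthCyclicPair k (K-I (n * k + 1))
proposition2p7 n k 1≤n 1≤k SH = SHStar⇒orthogonal-K SH 3≤k , SHStar⇒orthogonal-K-I SH 3≤k
  where 3≤k = IsHeffter⇒3≤k (SHStar.heffter SH) 1≤n 1≤k
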